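{- Let $G$ be a $K_4$-minor-free graph and $X$ a set of three vertices of $G$. If there is a proper $3$-coloring $\phi$ of $G$ with $|\phi(X)|=2$, then $X$ is feasible.
   Context: The chain of diamonds $D_n$ ($n\in\mathbb{N}$) has vertex set $\{u_i,v_i,w_i:i\in[n]\}\cup\{u_0\}$ and edges $\{u_{i-1}v_i,u_{i-1}w_i,v_iw_i,v_iu_i,w_iu_i:i\in[n]\}$; $U(D_n)=\{u_0,\dots,u_n\}$. A vertex set $X$ of $G$ is connected by a chain of diamonds if there are $n\in\mathbb{N}$ and a homomorphism $\varphi:D_n\to G$ with $X\subseteq\varphi(U(D_n))$. A set $X$ of three distinct vertices of $G$ is feasible if $X$ is not connected by a chain of diamonds and there is a proper $3$-coloring $\phi$ of $G$ with $|\phi(X)|\le2$. -}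

module Defs where

open import Data.Nat using (ℕ; suc; _≤_)
open import Data.Fin using (Fin; inject₁) renaming (suc to fsuc)
open import Data.Fin.Subset using (⁅_⁆; _∪_; ∣_∣)
open import Data.Product using (Σ; ∃; _×_)
open import Relation.Nullary using (¬_)
open import Relation.Binary.PropositionalEquality using (_≡_; _≢_)

record Graph (n : ℕ) : Set₁ where
  field
    Adj   : Fin n → Fin n → Set
    sym   : ∀ {a b} → Adj a b → Adj b a
    irrefl : ∀ {a} → ¬ Adj a a
open Graph public

module _ {n : ℕ} (G : Graph n) where

  data WalkIn (S : Fin n → Set) : Fin n → Fin n → Set where
    here : ∀ {a} → S a → WalkIn S a a
    step : ∀ {a b c} → S a → Adj G a b → WalkIn S b c → WalkIn S a c

  record K4Model : Set₁ where
    field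
      branch    : Fin 4 → Fin n → Set
      disjoint  : ∀ i j v → branch i v → branch j v → i ≡ j
      nonempty  : ∀ i → ∃ λ v → branch i v
      connected : ∀ i a b → branch i a → branch i b → WalkIn (branch i) a b
      linked    : ∀ i j → i ≢ j →
                  Σ (Fin n) λ a → Σ (Fin n) λ b → branch i a × branch j b × Adj G a b

  K4MinorFree : Set₁
  K4MinorFree = ¬ K4Model

  Proper3Coloring : (Fin n → Fin 3) → Set
  Proper3Coloring c = ∀ a b → Adj G a b → c a ≢ c b

  -- A homomorphism φ : D m → G of the chain of diamonds D m, given by the
  -- images u i (i = 0..m), v i, w i (i = 1..m; here indexed 0..m-1) of the
  -- vertices u_i, v_i, w_i, required to map every edge of D m onto an edge of G.
  record DiamondHom (m : ℕ) : Set where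
    field
      u : Fin (suc m) → Fin n
      v : Fin m → Fin n
      w : Fin m → Fin n
      uv : ∀ i → Adj G (u (inject₁ i)) (v i)
      uw : ∀ i → Adj G (u (inject₁ i)) (w i)
      vw : ∀ i → Adj G (v i) (w i)
      vu : ∀ i → Adj G (v i) (u (fsuc i))
      wu : ∀ i → Adj G (w i) (u (fsuc i))

  InU : ∀ {m} → DiamondHom m → Fin n → Set
  InU {m} φ x = ∃ λ (i : Fin (suc m)) → DiamondHom.u φ i ≡ x

  ConnectedByChain : Fin n → Fin n → Fin n → Set
  ConnectedByChain x y z =
    Σ ℕ λ m → Σ (DiamondHom m) λ φ → InU φ x × InU φ y × InU φ z

  imageSize : (Fin n → Fin 3) → Fin n → Fin n → Fin n → ℕ
  imageSize c x y z = ∣ ⁅ c x ⁆ ∪ (⁅ c y ⁆ ∪ ⁅ c z ⁆) ∣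

  Feasible : Fin n → Fin n → Fin n → Set
  Feasible x y z =
    ¬ ConnectedByChain x y z ×
    (∃ λ c → Proper3Coloring c × imageSize c x y z ≤ 2)

module Submission where

open import Defs
open import Data.Nat using (ℕ; suc)
open import Data.Nat.Properties using (≤-reflexive)
open import Data.Fin using (Fin; zero; inject₁) renaming (suc to fsuc)
open import Data.Fin.Properties using (punchOut-injective)
open import Data.Fin.Subset using (⁅_⁆; _∪_; ∣_∣)
open import Data.Fin.Subset.Properties using (∪-idem; ∣⁅x⁆∣≡1)
open import Data.Product using (∃; _×_; _,_)
open import Function using (_∘_)
open import Relation.Nullary using (¬_; contradiction)
open import Relation.Binary.PropositionalEquality
  using (_≡_; _≢_; refl; trans; cong; ≢-sym; module ≡-Reasoning)
  renaming (sym to ≡-sym)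

-- Every proper 3-colouring gives the two tips u_{i-1}, u_i of a diamond the
-- same colour, since both must avoid the two distinct colours of v_i and w_i.
-- Hence a chain of diamonds is monochromatic on U(D_n), and a triple whose
-- colours take two values cannot lie on one.

avoiding-one-in-Fin2 : {a d c : Fin 2} → a ≢ c → d ≢ c → a ≡ d
avoiding-one-in-Fin2 {zero}      {zero}                  _   _   = refl
avoiding-one-in-Fin2 {fsuc zero} {fsuc zero}             _   _   = refl
avoiding-one-in-Fin2 {zero}      {fsuc zero} {zero}      a≢c _   = contradiction refl a≢c
avoiding-one-in-Fin2 {zero}      {fsuc zero} {fsuc zero} _   d≢c = contradiction refl d≢c
avoiding-one-in-Fin2 {fsuc zero} {zero}      {zero}      _   d≢c = contradiction refl d≢c
avoiding-one-in-Fin2 {fsuc zero} {zero}      {fsuc zero} a≢c _   = contradiction refl a≢c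

-- Removing b with punchOut reduces the claim to Fin 2.
avoiding-two-in-Fin3 : {a d b c : Fin 3} → b ≢ c →
                       a ≢ b → a ≢ c → d ≢ b → d ≢ c → a ≡ d
avoiding-two-in-Fin3 b≢c a≢b a≢c d≢b d≢c =
  punchOut-injective b≢a b≢d
    (avoiding-one-in-Fin2 (a≢c ∘ punchOut-injective b≢a b≢c)
                          (d≢c ∘ punchOut-injective b≢d b≢c))
  where
  b≢a = ≢-sym a≢b
  b≢d = ≢-sym d≢b

adjacent-equal⇒constant : ∀ {A : Set} {m} (f : Fin (suc m) → A) →
                          (∀ i → f (inject₁ i) ≡ f (fsuc i)) → ∀ i → f i ≡ f zero
adjacent-equal⇒constant f adjacent zero = refl
adjacent-equal⇒constant {m = suc _} f adjacent (fsuc i) =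
  trans (adjacent-equal⇒constant (f ∘ fsuc) (adjacent ∘ fsuc) i) (≡-sym (adjacent zero))

module _ {n : ℕ} (G : Graph n) {c : Fin n → Fin 3} (proper : Proper3Coloring G c) where

  diamond-tips-same-colour : ∀ {a b d e} →
    Adj G a b → Adj G a d → Adj G b d → Adj G b e → Adj G d e → c a ≡ c e
  diamond-tips-same-colour ab ad bd be de =
    avoiding-two-in-Fin3 (proper _ _ bd) (proper _ _ ab) (proper _ _ ad)
                         (≢-sym (proper _ _ be)) (≢-sym (proper _ _ de))

  chain-monochromatic : ∀ {m} (φ : DiamondHom G m) →
                        ∀ i → c (DiamondHom.u φ i) ≡ c (DiamondHom.u φ zero)
  chain-monochromatic φ = adjacent-equal⇒constant (c ∘ u) λ i →
    diamond-tips-same-colour (uv i) (uw i) (vw i) (vu i) (wu i)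
    where open DiamondHom φ

  imageSize-monochromatic : ∀ {x y z k} → c x ≡ k → c y ≡ k → c z ≡ k →
                            imageSize G c x y z ≡ 1
  imageSize-monochromatic {k = k} cx≡k cy≡k cz≡k rewrite cx≡k | cy≡k | cz≡k = begin
    ∣ ⁅ k ⁆ ∪ (⁅ k ⁆ ∪ ⁅ k ⁆) ∣ ≡⟨ cong (λ s → ∣ ⁅ k ⁆ ∪ s ∣) (∪-idem ⁅ k ⁆) ⟩
    ∣ ⁅ k ⁆ ∪ ⁅ k ⁆ ∣           ≡⟨ cong ∣_∣ (∪-idem ⁅ k ⁆) ⟩
    ∣ ⁅ k ⁆ ∣                   ≡⟨ ∣⁅x⁆∣≡1 k ⟩
    1                           ∎
    where open ≡-Reasoning

  chain-imageSize : ∀ {x y z} → ConnectedByChain G x y z → imageSize G c x y z ≡ 1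
  chain-imageSize (_ , φ , (i , refl) , (j , refl) , (k , refl)) =
    imageSize-monochromatic (chain-monochromatic φ i) (chain-monochromatic φ j)
                            (chain-monochromatic φ k)

lemma3 : {n : ℕ} (G : Graph n) → K4MinorFree G →
         (x y z : Fin n) → x ≢ y → y ≢ z → x ≢ z →
         (∃ λ c → Proper3Coloring G c × imageSize G c x y z ≡ 2) →
         Feasible G x y z
lemma3 G _ x y z _ _ _ (c , proper , size≡2) = not-chain , c , proper , ≤-reflexive size≡2
  where
  not-chain : ¬ ConnectedByChain G x y z
  not-chain chain with () ← trans (≡-sym size≡2) (chain-imageSize G proper chain)
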